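{- Let $n\ge 2$, $j\in[[n]]$, and let $x=x_1\cdots x_{n-1}j$ be any vertex of the cluster $BP_n^j$ of the burnt pancake graph $BP_n$. Then the out-neighbours of the $n$ vertices of $N_{BP_n^j}[x]$ (the closed neighbourhood of $x$ in $BP_n^j$) belong to $n$ pairwise different clusters of $BP_n$.
   Context: Let $[n]=\{1,\dots,n\}$, $\bar i=-i$, $[[n]]=[n]\cup\{\bar i: i\in[n]\}$. A signed permutation of $[n]$ is a sequence $x=x_1\cdots x_n$ of elements of $[[n]]$ with $|x_1|\cdots|x_n|$ a permutation of $[n]$. For $1\le i\le n$, $x^i=\bar x_i\bar x_{i-1}\cdots\bar x_1x_{i+1}\cdots x_n$. The burnt pancake graph $BP_n$ has vertex set all signed permutations of $[n]$, with $x\sim y$ iff $y=x^i$ for some $1\le i\le n$. For $j\in[[n]]$, the cluster $BP_n^j$ is the subgraph induced by the vertices with last entry $j$; the $2n$ clusters partition $V(BP_n)$. An edge $xy$ of $BP_n$ with $x,y$ in different clusters is a cross edge, and then $y$ is called the out-neighbour of $x$, denoted $\hat x$; each vertex $x$ has exactly one out-neighbour, namely $x^n$. $N_{BP_n^j}[x]$ denotes $\{x\}$ together with the neighbours of $x$ in $BP_n^j$. -}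

module Defs where

open import Data.Nat using (ℕ; suc; _≤_)
open import Data.Integer using (ℤ; -_; ∣_∣)
open import Data.List using (List; map; reverse; take; drop; _++_; upTo; last)
open import Data.Maybe using (Maybe)
open import Data.Product using (Σ; ∃; _×_)
open import Data.Sum using (_⊎_)
open import Relation.Binary.PropositionalEquality using (_≡_)
open import Data.List.Relation.Binary.Permutation.Propositional using (_↭_)

-- A signed permutation of [n], written as the list x₁ ⋯ xₙ of integers
-- (ī = -i): |x₁| ⋯ |xₙ| is a permutation of [n] = 1,…,n.
IsSignedPerm : ℕ → List ℤ → Set
IsSignedPerm n x = map ∣_∣ x ↭ map suc (upTo n)

flip : ℕ → List ℤ → List ℤ
flip i x = map -_ (reverse (take i x)) ++ drop i x

Adj : ℕ → List ℤ → List ℤ → Set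
Adj n x y = ∃ λ i → (1 ≤ i × i ≤ n) × y ≡ flip i x

-- last entry (the cluster index); clusters are determined by it
lastEntry : List ℤ → Maybe ℤ
lastEntry = last

InCluster : ℤ → List ℤ → Set
InCluster j y = lastEntry y ≡ Data.Maybe.just j

InClosedNbhd : ℕ → ℤ → List ℤ → List ℤ → Set
InClosedNbhd n j x y = (y ≡ x ⊎ Adj n x y) × InCluster j y

outNeighbour : ℕ → List ℤ → List ℤ
outNeighbour n x = flip n x

-- The out-neighbour of x^i lies in the cluster of the negated first entry of x^i: of −x₁ for i = 0
-- (x^0 = x) and of xᵢ for i ≥ 1. Inside the cluster of x only i < n occurs, since x^n ends in −x₁
-- and |x₁| ≠ |xₙ|. The labels −x₁, x₁, …, x_{n−1} are pairwise distinct because the |xₖ| are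
-- distinct and x₁ ≠ 0.
module Submission where

open import Defs
open import Data.Nat using (ℕ; zero; suc; pred; _+_; _≤_; _<_; z≤n; s≤s)
open import Data.Nat.Properties using (≤-refl; <⇒≤; <-≤-trans; 0≢1+n; suc-injective; m≤n⇒m<n∨m≡n)
open import Data.Integer using (ℤ; -_; ∣_∣; +_)
open import Data.Integer.Properties using (neg-injective; ∣-i∣≡∣i∣)
open import Data.List using (List; []; _∷_; map; reverse; take; drop; _++_; _ʳ++_; _∷ʳ_; upTo; head; last; length)
open import Data.List.Properties
  using (last-map; reverse-map; ʳ++-defn; unfold-reverse; length-++; length-map; length-reverse;
         take++drop≡id; take-all; drop-all; ++-identityʳ; length-upTo)
open import Data.List.Membership.Propositional using (_∈_)
open import Data.List.Membership.Propositional.Properties using (∈-map⁺; ∈-map⁻)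
open import Data.List.Relation.Unary.All as All using (All)
open import Data.List.Relation.Unary.Any using (here; there)
open import Data.List.Relation.Unary.AllPairs using (_∷_)
open import Data.List.Relation.Unary.Unique.Propositional using (Unique)
import Data.List.Relation.Unary.Unique.Propositional.Properties as Unique
open import Data.List.Relation.Binary.Permutation.Propositional using (↭-sym; ↭⇒↭ₛ)
open import Data.List.Relation.Binary.Permutation.Propositional.Properties using (↭-length; ∈-resp-↭)
import Data.List.Relation.Binary.Permutation.Setoid.Properties as Permutationₛ
open import Data.Maybe using (Maybe; just; nothing)
import Data.Maybe as Maybe
open import Data.Maybe.Properties using (map-∘; map-cong; map-injective; just-injective)
open import Data.Product using (∃; _×_; _,_)
open import Data.Sum using (inj₁; inj₂)
open import Data.Empty using (⊥-elim)
open import Relation.Binary.PropositionalEquality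
open ≡-Reasoning

i≡-i⇒i≡0 : ∀ {i} → i ≡ - i → i ≡ + 0
i≡-i⇒i≡0 {+ zero} _ = refl

map-∣-∣-neg : ∀ (m : Maybe ℤ) → Maybe.map ∣_∣ (Maybe.map -_ m) ≡ Maybe.map ∣_∣ m
map-∣-∣-neg m = trans (sym (map-∘ m)) (map-cong ∣-i∣≡∣i∣ m)

-- 0-based, like take and drop: entry xs 0 is the first entry x₁.
entry : ∀ {A : Set} → List A → ℕ → Maybe A
entry []       _       = nothing
entry (a ∷ _)  zero    = just a
entry (_ ∷ xs) (suc k) = entry xs k

entry-map : ∀ {A B : Set} (f : A → B) xs k → entry (map f xs) k ≡ Maybe.map f (entry xs k)
entry-map f []       k       = refl
entry-map f (a ∷ xs) zero    = refl
entry-map f (a ∷ xs) (suc k) = entry-map f xs k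

∈-entry : ∀ {A : Set} {xs : List A} {k c} → entry xs k ≡ just c → c ∈ xs
∈-entry {xs = a ∷ xs} {zero}  refl = here refl
∈-entry {xs = a ∷ xs} {suc k} e    = there (∈-entry e)

entry-injective : ∀ {A : Set} {xs : List A} {k k'} → Unique xs → k < length xs →
                  entry xs k ≡ entry xs k' → k ≡ k'
entry-injective {xs = a ∷ xs} {zero}  {zero}   _          _         _ = refl
entry-injective {xs = a ∷ xs} {zero}  {suc k'} (a∉ ∷ _)   _         e = ⊥-elim (All.lookup a∉ (∈-entry (sym e)) refl)
entry-injective {xs = a ∷ xs} {suc k} {zero}   (a∉ ∷ _)   _         e = ⊥-elim (All.lookup a∉ (∈-entry e) refl)
entry-injective {xs = a ∷ xs} {suc k} {suc k'} (_ ∷ uxs) (s≤s k<) e = cong suc (entry-injective uxs k< e)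

last-take : ∀ {A : Set} k (xs : List A) → k < length xs → last (take (suc k) xs) ≡ entry xs k
last-take zero    (a ∷ xs)     _         = refl
last-take (suc k) (a ∷ b ∷ xs) (s≤s k<) = last-take k (b ∷ xs) k<

last≡entry-length : ∀ {A : Set} (a : A) xs → last (a ∷ xs) ≡ entry (a ∷ xs) (length xs)
last≡entry-length a []       = refl
last≡entry-length a (b ∷ xs) = last≡entry-length b xs

head-ʳ++ : ∀ {A : Set} (a : A) ys zs → head ((a ∷ ys) ʳ++ zs) ≡ last (a ∷ ys)
head-ʳ++ a []       zs = refl
head-ʳ++ a (b ∷ ys) zs = head-ʳ++ b ys (a ∷ zs)

last-∷ʳ : ∀ {A : Set} (xs : List A) a → last (xs ∷ʳ a) ≡ just a
last-∷ʳ []           a = refl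
last-∷ʳ (b ∷ [])     a = refl
last-∷ʳ (b ∷ c ∷ xs) a = last-∷ʳ (c ∷ xs) a

last-reverse : ∀ {A : Set} (xs : List A) → last (reverse xs) ≡ head xs
last-reverse []       = refl
last-reverse (a ∷ xs) = trans (cong last (unfold-reverse a xs)) (last-∷ʳ (reverse xs) a)

length-flip : ∀ i xs → length (flip i xs) ≡ length xs
length-flip i xs = begin
  length (map -_ (reverse (take i xs)) ++ drop i xs)   ≡⟨ length-++ (map -_ (reverse (take i xs))) ⟩
  length (map -_ (reverse (take i xs))) + length (drop i xs)
    ≡⟨ cong (_+ length (drop i xs)) (trans (length-map -_ (reverse (take i xs))) (length-reverse (take i xs))) ⟩
  length (take i xs) + length (drop i xs)              ≡⟨ sym (length-++ (take i xs)) ⟩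
  length (take i xs ++ drop i xs)                      ≡⟨ cong length (take++drop≡id i xs) ⟩
  length xs                                            ∎

head-flip-suc : ∀ k xs → head (flip (suc k) xs) ≡ Maybe.map -_ (last (take (suc k) xs))
head-flip-suc k []       = refl
head-flip-suc k (a ∷ xs) = begin
  head (map -_ (reverse (a ∷ take k xs)) ++ drop k xs)   ≡⟨ cong (λ ys → head (ys ++ drop k xs)) (reverse-map -_ (a ∷ take k xs)) ⟩
  head (reverse (map -_ (a ∷ take k xs)) ++ drop k xs)   ≡⟨ cong head (sym (ʳ++-defn (map -_ (a ∷ take k xs)))) ⟩
  head (map -_ (a ∷ take k xs) ʳ++ drop k xs)            ≡⟨ head-ʳ++ (- a) (map -_ (take k xs)) (drop k xs) ⟩
  last (map -_ (a ∷ take k xs))                          ≡⟨ last-map -_ (a ∷ take k xs) ⟩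
  Maybe.map -_ (last (a ∷ take k xs))                    ∎

last-flip-length : ∀ xs → last (flip (length xs) xs) ≡ Maybe.map -_ (head xs)
last-flip-length xs = begin
  last (map -_ (reverse (take (length xs) xs)) ++ drop (length xs) xs)
    ≡⟨ cong₂ (λ ys zs → last (map -_ (reverse ys) ++ zs)) (take-all _ xs ≤-refl) (drop-all _ xs ≤-refl) ⟩
  last (map -_ (reverse xs) ++ [])   ≡⟨ cong last (++-identityʳ (map -_ (reverse xs))) ⟩
  last (map -_ (reverse xs))         ≡⟨ last-map -_ (reverse xs) ⟩
  Maybe.map -_ (last (reverse xs))   ≡⟨ cong (Maybe.map -_) (last-reverse xs) ⟩
  Maybe.map -_ (head xs)             ∎

lastEntry-outNeighbour : ∀ {n} xs → length xs ≡ n → lastEntry (outNeighbour n xs) ≡ Maybe.map -_ (head xs)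
lastEntry-outNeighbour xs refl = last-flip-length xs

∣head-flip∣ : ∀ i xs → i < length xs → Maybe.map ∣_∣ (head (flip i xs)) ≡ entry (map ∣_∣ xs) (pred i)
∣head-flip∣ zero    (a ∷ xs) _  = refl
∣head-flip∣ (suc k) xs       k< = begin
  Maybe.map ∣_∣ (head (flip (suc k) xs))                  ≡⟨ cong (Maybe.map ∣_∣) (head-flip-suc k xs) ⟩
  Maybe.map ∣_∣ (Maybe.map -_ (last (take (suc k) xs)))   ≡⟨ map-∣-∣-neg (last (take (suc k) xs)) ⟩
  Maybe.map ∣_∣ (last (take (suc k) xs))                  ≡⟨ cong (Maybe.map ∣_∣) (last-take k xs (<⇒≤ k<)) ⟩
  Maybe.map ∣_∣ (entry xs k)                              ≡⟨ sym (entry-map ∣_∣ xs k) ⟩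
  entry (map ∣_∣ xs) k                                    ∎

head≢head-flip-suc : ∀ {xs k} → Unique (map ∣_∣ xs) → All (_≢ + 0) xs → suc k < length xs →
                     head xs ≢ head (flip (suc k) xs)
head≢head-flip-suc {a ∷ xs} {k} u (a≢0 All.∷ _) k< e
  with entry-injective {k = 0} {k' = k} u (s≤s z≤n) (trans (cong (Maybe.map ∣_∣) e) (∣head-flip∣ (suc k) (a ∷ xs) k<))
... | refl = a≢0 (i≡-i⇒i≡0 (just-injective e))

head-flip-injective : ∀ {xs i i'} → Unique (map ∣_∣ xs) → All (_≢ + 0) xs → i < length xs → i' < length xs →
                      head (flip i xs) ≡ head (flip i' xs) → i ≡ i'
head-flip-injective {xs} {zero}  {zero}   _ _  _  _   _ = refl
head-flip-injective {xs} {zero}  {suc k'} u nz _  i'< e = ⊥-elim (head≢head-flip-suc u nz i'< e)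
head-flip-injective {xs} {suc k} {zero}   u nz i< _   e = ⊥-elim (head≢head-flip-suc u nz i< (sym e))
head-flip-injective {xs} {suc k} {suc k'} u _  i< i'< e =
  cong suc (entry-injective u (subst (k <_) (sym (length-map ∣_∣ xs)) (<⇒≤ i<))
             (trans (sym (∣head-flip∣ (suc k) xs i<)) (trans (cong (Maybe.map ∣_∣) e) (∣head-flip∣ (suc k') xs i'<))))

last-flip-length≢last : ∀ {xs} → Unique (map ∣_∣ xs) → 2 ≤ length xs → last (flip (length xs) xs) ≢ last xs
last-flip-length≢last {a ∷ b ∷ ys} u (s≤s (s≤s _)) e = 0≢1+n {length ys} (entry-injective u (s≤s z≤n) (begin
  just ∣ a ∣                                             ≡⟨ sym (map-∣-∣-neg (just a)) ⟩
  Maybe.map ∣_∣ (Maybe.map -_ (just a))                 ≡⟨ cong (Maybe.map ∣_∣) (trans (sym (last-flip-length (a ∷ b ∷ ys))) e) ⟩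
  Maybe.map ∣_∣ (last (a ∷ b ∷ ys))                     ≡⟨ cong (Maybe.map ∣_∣) (last≡entry-length a (b ∷ ys)) ⟩
  Maybe.map ∣_∣ (entry (a ∷ b ∷ ys) (suc (length ys)))  ≡⟨ sym (entry-map ∣_∣ (a ∷ b ∷ ys) (suc (length ys))) ⟩
  entry (map ∣_∣ (a ∷ b ∷ ys)) (suc (length ys))         ∎))

module _ {n : ℕ} {xs : List ℤ} (sp : IsSignedPerm n xs) where

  length-signedPerm : length xs ≡ n
  length-signedPerm = begin
    length xs                 ≡⟨ sym (length-map ∣_∣ xs) ⟩
    length (map ∣_∣ xs)       ≡⟨ ↭-length sp ⟩
    length (map suc (upTo n)) ≡⟨ length-map suc (upTo n) ⟩
    length (upTo n)           ≡⟨ length-upTo n ⟩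
    n                         ∎

  unique-signedPerm : Unique (map ∣_∣ xs)
  unique-signedPerm = Permutationₛ.Unique-resp-↭ (setoid ℕ) (↭⇒↭ₛ (↭-sym sp))
                        (Unique.map⁺ suc-injective (Unique.upTo⁺ n))

  nonzero-signedPerm : All (_≢ + 0) xs
  nonzero-signedPerm = All.tabulate λ a∈xs a≡0 →
    let (k , _ , ∣a∣≡1+k) = ∈-map⁻ suc (∈-resp-↭ sp (∈-map⁺ ∣_∣ a∈xs))
    in 0≢1+n (trans (cong ∣_∣ (sym a≡0)) ∣a∣≡1+k)

closedNbhd⇒flip : ∀ {n j x y} → IsSignedPerm n x → 2 ≤ n → InCluster j x → InClosedNbhd n j x y →
                  ∃ λ i → i < n × y ≡ flip i x
closedNbhd⇒flip sp 2≤n _ (inj₁ refl , _) = 0 , <-≤-trans (s≤s z≤n) 2≤n , refl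
closedNbhd⇒flip {n} {x = x} sp 2≤n x∈j (inj₂ (i , (_ , i≤n) , refl) , y∈j) with m≤n⇒m<n∨m≡n i≤n
... | inj₁ i<n  = i , i<n , refl
... | inj₂ refl = ⊥-elim (subst (λ m → last (flip m x) ≢ last x) ℓ
                            (last-flip-length≢last (unique-signedPerm sp) (subst (2 ≤_) (sym ℓ) 2≤n))
                            (trans y∈j (sym x∈j)))
  where
  ℓ : length x ≡ n
  ℓ = length-signedPerm sp

lemma8 : (n : ℕ) → 2 ≤ n → (j : ℤ) → (x : List ℤ) → IsSignedPerm n x → InCluster j x →
           (y z : List ℤ) → InClosedNbhd n j x y → InClosedNbhd n j x z →
           lastEntry (outNeighbour n y) ≡ lastEntry (outNeighbour n z) → y ≡ z
lemma8 n 2≤n _ x sp x∈j y z y∈N z∈N same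
  with closedNbhd⇒flip sp 2≤n x∈j y∈N | closedNbhd⇒flip sp 2≤n x∈j z∈N
... | i , i<n , refl | i' , i'<n , refl =
  cong (λ k → flip k x)
       (head-flip-injective (unique-signedPerm sp) (nonzero-signedPerm sp) (bound i<n) (bound i'<n)
                            (map-injective neg-injective (trans (sym (out i)) (trans same (out i')))))
  where
  ℓ : length x ≡ n
  ℓ = length-signedPerm sp

  bound : ∀ {k} → k < n → k < length x
  bound = subst (_ <_) (sym ℓ)

  out : ∀ k → lastEntry (outNeighbour n (flip k x)) ≡ Maybe.map -_ (head (flip k x))
  out k = lastEntry-outNeighbour (flip k x) (trans (length-flip k x) ℓ)
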